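{- For every integer $r\ge 2$, $R^{\mathrm{KG}}_r(3,3)\ge 3r+2$.
   Context: The Kneser graph $\mathrm{KG}(n,r)$ has vertex set the $r$-element subsets of $[n]=\{1,\dots,n\}$, with two sets adjacent iff they are disjoint. The $r$-Kneser Ramsey number $R^{\mathrm{KG}}_r(s,t)$ is the minimum integer $n$ such that every red/blue edge-coloring of $\mathrm{KG}(n,r)$ contains a red $K_s$ (a set of $s$ pairwise adjacent vertices with all connecting edges red) or a blue $K_t$. -}

module Defs where

open import Data.Nat using (ℕ)
open import Data.Bool using (Bool; true; false)
open import Data.Fin.Subset using (Subset; ∣_∣; _∩_; Empty)
open import Data.Product using (Σ; _×_; ∃-syntax)
open import Data.Sum using (_⊎_)
open import Relation.Binary.PropositionalEquality using (_≡_; _≢_)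

IsVertex : (n r : ℕ) → Subset n → Set
IsVertex n r A = ∣ A ∣ ≡ r

Disjoint : {n : ℕ} → Subset n → Subset n → Set
Disjoint A B = Empty (A ∩ B)

-- A red/blue edge colouring of KG(n,r): a colour (true = red, false = blue)
-- assigned to each pair of subsets, required to be symmetric on edges
-- (so it is really a colouring of the unordered edges). Values on non-edges
-- are irrelevant.
Colouring : ℕ → Set
Colouring n = Subset n → Subset n → Bool

IsEdgeColouring : (n r : ℕ) → Colouring n → Set
IsEdgeColouring n r c =
  ∀ A B → IsVertex n r A → IsVertex n r B → Disjoint A B → c A B ≡ c B A

MonoTriangle : (n r : ℕ) → Colouring n → Bool → Set
MonoTriangle n r c col =
  Σ (Subset n) λ A → Σ (Subset n) λ B → Σ (Subset n) λ C →
    (IsVertex n r A × IsVertex n r B × IsVertex n r C) ×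
    (A ≢ B × A ≢ C × B ≢ C) ×
    (Disjoint A B × Disjoint A C × Disjoint B C) ×
    (c A B ≡ col × c A C ≡ col × c B C ≡ col)

KneserArrows33 : (n r : ℕ) → Set
KneserArrows33 n r =
  (c : Colouring n) → IsEdgeColouring n r c →
  MonoTriangle n r c true ⊎ MonoTriangle n r c false

-- Fix a set S of two points of [n] and colour an edge of KG(n,r) red iff exactly
-- one of its ends meets S. By parity there is no red triangle, and the vertices
-- of a blue triangle either all meet S, which three pairwise disjoint sets cannot
-- do when |S| = 2, or all avoid S, which forces 3r ≤ n − 2.
module Submission where

open import Defs
open import Data.Nat using (ℕ; suc; _≤_; _+_; _*_; z≤n; s≤s)
open import Data.Nat.Properties
  using (≤-trans; ≤-reflexive; m≤m+n; +-mono-≤; +-suc; <⇒≱; module ≤-Reasoning)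
open import Data.Nat.Tactic.RingSolver using (solve-∀)
open import Data.Bool using (Bool; true; false; _xor_)
open import Data.Bool.Properties using (xor-comm)
open import Data.Vec using ([]; _∷_; here)
open import Data.Fin using (zero)
open import Data.Fin.Subset
  using (Subset; ∣_∣; _∩_; _∪_; _⊆_; Nonempty; ⊥; inside; outside)
open import Data.Fin.Subset.Properties
  using (∣⊥∣≡0; ∣p∣≤n; p⊆q⇒∣p∣≤∣q∣; p∩q⊆p; p∩q⊆q; x∈p∩q⁺; x∈p∩q⁻; x∈p∪q⁻;
         drop-∷-Empty; nonempty?; x∈p⇒∣p-x∣<∣p∣)
open import Data.Product using (Σ; _×_; _,_; proj₁; proj₂)
open import Data.Sum using (_⊎_; inj₁; inj₂; [_,_]′)
open import Function using (id)
open import Relation.Nullary using (yes; no; does; contradiction)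
open import Relation.Binary.PropositionalEquality
  using (_≡_; refl; sym; trans; cong; subst)
open import Relation.Binary.PropositionalEquality.Properties using (module ≡-Reasoning)

private
  variable
    n : ℕ
    p s : Subset n

∣p∪q∣≡∣p∣+∣q∣ : (p q : Subset n) → Disjoint p q → ∣ p ∪ q ∣ ≡ ∣ p ∣ + ∣ q ∣
∣p∪q∣≡∣p∣+∣q∣ []            []            _ = refl
∣p∪q∣≡∣p∣+∣q∣ (inside  ∷ p) (inside  ∷ q) d = contradiction (zero , here) d
∣p∪q∣≡∣p∣+∣q∣ (inside  ∷ p) (outside ∷ q) d = cong suc (∣p∪q∣≡∣p∣+∣q∣ p q (drop-∷-Empty d))
∣p∪q∣≡∣p∣+∣q∣ (outside ∷ p) (inside  ∷ q) d =
  trans (cong suc (∣p∪q∣≡∣p∣+∣q∣ p q (drop-∷-Empty d))) (sym (+-suc ∣ p ∣ ∣ q ∣))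
∣p∪q∣≡∣p∣+∣q∣ (outside ∷ p) (outside ∷ q) d = ∣p∪q∣≡∣p∣+∣q∣ p q (drop-∷-Empty d)

Disjoint-∪ˡ : (p q s : Subset n) → Disjoint p s → Disjoint q s → Disjoint (p ∪ q) s
Disjoint-∪ˡ p q s p#s q#s (x , x∈p∪q∩s) with x∈p∩q⁻ (p ∪ q) s x∈p∪q∩s
... | x∈p∪q , x∈s with x∈p∪q⁻ p q x∈p∪q
...   | inj₁ x∈p = p#s (x , x∈p∩q⁺ (x∈p , x∈s))
...   | inj₂ x∈q = q#s (x , x∈p∩q⁺ (x∈q , x∈s))

Disjoint-∩ʳ : (p q s : Subset n) → Disjoint p q → Disjoint (p ∩ s) (q ∩ s)
Disjoint-∩ʳ p q s p#q (x , x∈) with x∈p∩q⁻ (p ∩ s) (q ∩ s) x∈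
... | x∈p∩s , x∈q∩s = p#q (x , x∈p∩q⁺ (p∩q⊆p p s x∈p∩s , p∩q⊆p q s x∈q∩s))

∪-⊆ : (p q : Subset n) → p ⊆ s → q ⊆ s → p ∪ q ⊆ s
∪-⊆ p q p⊆s q⊆s x∈p∪q with x∈p∪q⁻ p q x∈p∪q
... | inj₁ x∈p = p⊆s x∈p
... | inj₂ x∈q = q⊆s x∈q

Nonempty⇒1≤∣p∣ : Nonempty p → 1 ≤ ∣ p ∣
Nonempty⇒1≤∣p∣ (x , x∈p) = ≤-trans (s≤s z≤n) (x∈p⇒∣p-x∣<∣p∣ x∈p)

∣[p∪q]∪s∣≡∣p∣+∣q∣+∣s∣ : (p q s : Subset n) → Disjoint p q → Disjoint p s → Disjoint q s →
                        ∣ (p ∪ q) ∪ s ∣ ≡ ∣ p ∣ + ∣ q ∣ + ∣ s ∣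
∣[p∪q]∪s∣≡∣p∣+∣q∣+∣s∣ p q s p#q p#s q#s = begin
  ∣ (p ∪ q) ∪ s ∣      ≡⟨ ∣p∪q∣≡∣p∣+∣q∣ (p ∪ q) s (Disjoint-∪ˡ p q s p#s q#s) ⟩
  ∣ p ∪ q ∣ + ∣ s ∣    ≡⟨ cong (_+ ∣ s ∣) (∣p∪q∣≡∣p∣+∣q∣ p q p#q) ⟩
  ∣ p ∣ + ∣ q ∣ + ∣ s ∣ ∎
  where open ≡-Reasoning

disjoint-meeting⇒3≤∣s∣ : (A B C s : Subset n) → Disjoint A B → Disjoint A C → Disjoint B C →
                         Nonempty (A ∩ s) → Nonempty (B ∩ s) → Nonempty (C ∩ s) → 3 ≤ ∣ s ∣
disjoint-meeting⇒3≤∣s∣ A B C s A#B A#C B#C A∩s≠∅ B∩s≠∅ C∩s≠∅ = begin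
  3                                  ≤⟨ +-mono-≤ (+-mono-≤ (Nonempty⇒1≤∣p∣ A∩s≠∅) (Nonempty⇒1≤∣p∣ B∩s≠∅))
                                                 (Nonempty⇒1≤∣p∣ C∩s≠∅) ⟩
  ∣ A ∩ s ∣ + ∣ B ∩ s ∣ + ∣ C ∩ s ∣  ≡⟨ sym (∣[p∪q]∪s∣≡∣p∣+∣q∣+∣s∣ (A ∩ s) (B ∩ s) (C ∩ s)
                                          (Disjoint-∩ʳ A B s A#B) (Disjoint-∩ʳ A C s A#C)
                                          (Disjoint-∩ʳ B C s B#C)) ⟩
  ∣ (A ∩ s ∪ B ∩ s) ∪ C ∩ s ∣        ≤⟨ p⊆q⇒∣p∣≤∣q∣ (∪-⊆ (A ∩ s ∪ B ∩ s) (C ∩ s)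
                                          (∪-⊆ (A ∩ s) (B ∩ s) (p∩q⊆q A s) (p∩q⊆q B s))
                                          (p∩q⊆q C s)) ⟩
  ∣ s ∣                              ∎
  where open ≤-Reasoning

disjoint-avoiding⇒sum≤n : (A B C s : Subset n) → Disjoint A B → Disjoint A C → Disjoint B C →
                          Disjoint A s → Disjoint B s → Disjoint C s →
                          ∣ A ∣ + ∣ B ∣ + ∣ C ∣ + ∣ s ∣ ≤ n
disjoint-avoiding⇒sum≤n {n} A B C s A#B A#C B#C A#s B#s C#s = begin
  ∣ A ∣ + ∣ B ∣ + ∣ C ∣ + ∣ s ∣  ≡⟨ cong (_+ ∣ s ∣)
                                       (sym (∣[p∪q]∪s∣≡∣p∣+∣q∣+∣s∣ A B C A#B A#C B#C)) ⟩
  ∣ (A ∪ B) ∪ C ∣ + ∣ s ∣        ≡⟨ sym (∣p∪q∣≡∣p∣+∣q∣ ((A ∪ B) ∪ C) s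
                                       (Disjoint-∪ˡ (A ∪ B) C s (Disjoint-∪ˡ A B s A#s B#s) C#s)) ⟩
  ∣ ((A ∪ B) ∪ C) ∪ s ∣          ≤⟨ ∣p∣≤n (((A ∪ B) ∪ C) ∪ s) ⟩
  n                              ∎
  where open ≤-Reasoning

xor-monochromatic⇒equal : ∀ {b} x y z → x xor y ≡ b → x xor z ≡ b → y xor z ≡ b → x ≡ y × x ≡ z
xor-monochromatic⇒equal true  true  true  _    _  _  = refl , refl
xor-monochromatic⇒equal true  true  false refl () _
xor-monochromatic⇒equal true  false true  refl () _
xor-monochromatic⇒equal true  false false refl _  ()
xor-monochromatic⇒equal false true  true  refl _  ()
xor-monochromatic⇒equal false true  false refl () _
xor-monochromatic⇒equal false false true  refl () _
xor-monochromatic⇒equal false false false _    _  _  = refl , refl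

meets : Subset n → Subset n → Bool
meets s A = does (nonempty? (A ∩ s))

meets-true : (s A : Subset n) → meets s A ≡ true → Nonempty (A ∩ s)
meets-true s A _ with nonempty? (A ∩ s)
... | yes A∩s≠∅ = A∩s≠∅
meets-true s A () | no _

meets-false : (s A : Subset n) → meets s A ≡ false → Disjoint A s
meets-false s A _ with nonempty? (A ∩ s)
... | no A∩s≡∅ = A∩s≡∅
meets-false s A () | yes _

crossingColouring : Subset n → Colouring n
crossingColouring s A B = meets s A xor meets s B

crossingColouring-isEdgeColouring : ∀ {r} (s : Subset n) → IsEdgeColouring n r (crossingColouring s)
crossingColouring-isEdgeColouring s A B _ _ _ = xor-comm (meets s A) (meets s B)

crossingColouring-monoTriangle : ∀ {r col} (s : Subset n) → MonoTriangle n r (crossingColouring s) col →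
                                 3 ≤ ∣ s ∣ ⊎ 3 * r + ∣ s ∣ ≤ n
crossingColouring-monoTriangle {n} {r} s
  (A , B , C , (∣A∣≡r , ∣B∣≡r , ∣C∣≡r) , _ , (A#B , A#C , B#C) , (cAB , cAC , cBC))
  with xor-monochromatic⇒equal (meets s A) (meets s B) (meets s C) cAB cAC cBC
... | A~B , A~C with meets s A in A~s
...   | true  = inj₁ (disjoint-meeting⇒3≤∣s∣ A B C s A#B A#C B#C
                        (meets-true s A A~s) (meets-true s B (sym A~B)) (meets-true s C (sym A~C)))
...   | false = inj₂ (begin
      3 * r + ∣ s ∣                  ≡⟨ cong (_+ ∣ s ∣) (sym sizes) ⟩
      ∣ A ∣ + ∣ B ∣ + ∣ C ∣ + ∣ s ∣  ≤⟨ disjoint-avoiding⇒sum≤n A B C s A#B A#C B#C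
                                          (meets-false s A A~s) (meets-false s B (sym A~B))
                                          (meets-false s C (sym A~C)) ⟩
      n                              ∎)
  where
  open ≤-Reasoning
  sizes : ∣ A ∣ + ∣ B ∣ + ∣ C ∣ ≡ 3 * r
  sizes rewrite ∣A∣≡r | ∣B∣≡r | ∣C∣≡r = r+r+r≡3*r r
    where
    r+r+r≡3*r : ∀ r → r + r + r ≡ 3 * r
    r+r+r≡3*r = solve-∀

kneserArrows33⇒3r+∣s∣≤n : ∀ {r} → KneserArrows33 n r → (s : Subset n) → ∣ s ∣ ≤ 2 → 3 * r + ∣ s ∣ ≤ n
kneserArrows33⇒3r+∣s∣≤n {n} {r} arrows s ∣s∣≤2 =
  [ bound , bound ]′ (arrows (crossingColouring s) (crossingColouring-isEdgeColouring s))
  where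
  bound : ∀ {col} → MonoTriangle n r (crossingColouring s) col → 3 * r + ∣ s ∣ ≤ n
  bound triangle = [ (λ 3≤∣s∣ → contradiction ∣s∣≤2 (<⇒≱ 3≤∣s∣)) , id ]′
                     (crossingColouring-monoTriangle s triangle)

subset-of-size : ∀ {k} → k ≤ n → Σ (Subset n) λ s → ∣ s ∣ ≡ k
subset-of-size {n} z≤n = ⊥ , ∣⊥∣≡0 n
subset-of-size (s≤s k≤n) with subset-of-size k≤n
... | s , ∣s∣≡k = inside ∷ s , cong suc ∣s∣≡k

theorem1p11 : (r : ℕ) → 2 ≤ r → (n : ℕ) → KneserArrows33 n r → 3 * r + 2 ≤ n
theorem1p11 r 2≤r n arrows =
  subst (λ k → 3 * r + k ≤ n) ∣pair∣≡2 (kneserArrows33⇒3r+∣s∣≤n arrows pair (≤-reflexive ∣pair∣≡2))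
  where
  -- For s = ∅ the crossing colouring is all blue.
  3r≤n : 3 * r ≤ n
  3r≤n = ≤-trans (m≤m+n (3 * r) ∣ ⊥ {n = n} ∣)
                 (kneserArrows33⇒3r+∣s∣≤n arrows (⊥ {n = n}) (≤-trans (≤-reflexive (∣⊥∣≡0 n)) z≤n))
  2≤n : 2 ≤ n
  2≤n = ≤-trans 2≤r (≤-trans (m≤m+n r (2 * r)) 3r≤n)
  pair : Subset n
  pair = proj₁ (subset-of-size 2≤n)
  ∣pair∣≡2 : ∣ pair ∣ ≡ 2
  ∣pair∣≡2 = proj₂ (subset-of-size 2≤n)
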